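{- Let $t<n/3$. The following protocol GC on $n$ processors, where $p_i$ has input bit $x_i$, solves binary Commit-Adopt against a mobile Byzantine $t$-MAd adversary. (1) Run the one-round protocol WC: each $p_i$ sends $x_i$ to every $p_j$; $p_j$ lets $Q_j^0$, $Q_j^1$ be the sets of processors from which it received $0$, resp. $1$, and sets $y_j:=0$ if $|Q_j^0|>2n/3$, else $y_j:=1$ if $|Q_j^1|>2n/3$, else $y_j:=\bot$. (2) Each $p_i$ sends $y_i$ to every $p_j$; $p_j$ lets $P_j^0$, $P_j^1$ be the sets of processors from which it received $0$, resp. $1$. (3) Each $p_j$ sets $b_j:=0$ if $|P_j^0|\ge|P_j^1|$ and $b_j:=1$ otherwise. (4) Each $p_j$ outputs $commit(b_j)$ if $|P_j^{b_j}|>2n/3$ and $adopt(b_j)$ otherwise.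
   Context: System: $n$ processors run a synchronous round-based protocol; each round every processor sends a (possibly different) message to every processor over dedicated point-to-point channels whose receiver knows the sender identity; messages of round $\rho$ are delivered by the start of round $\rho+1$. A message adversary (MAd) sees all messages; in the Byzantine type it may delete or arbitrarily replace any outgoing message, in a given round, of the processors it corrupts in that round; it never alters internal states, inputs, outputs or incoming messages. A mobile $t$-MAd adversary corrupts at most $t$ processors in each round, possibly a different set each round. Every processor (corrupted or not) must output and the task conditions apply to all processors. Binary Commit-Adopt: each processor has an input bit and outputs $commit(v)$ or $adopt(v)$ for a bit $v$; if all inputs equal $v$ all output $commit(v)$; if some processor outputs $commit(v)$ then every processor outputs $commit(v)$ or $adopt(v)$. -}

module Defs where

open import Data.Nat using (ℕ; _*_; _≤_; _<ᵇ_; _≤ᵇ_)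
open import Data.Bool using (Bool; true; false; if_then_else_)
open import Data.Maybe using (Maybe; just; nothing)
open import Data.Fin using (Fin)
open import Data.Fin.Subset using (Subset; _∉_; ∣_∣)
open import Data.Vec using (tabulate)
open import Data.Product using (_×_)
open import Data.Sum using (_⊎_)
open import Relation.Binary.PropositionalEquality using (_≡_)

-- Binary values: false = 0, true = 1.
-- A (received) message is a value of type Maybe Bool:
--   just v  = the bit v,
--   nothing = the symbol ⊥, a deleted message, or any other junk
--             (all of these are counted in neither Q⁰/Q¹ nor P⁰/P¹).

isBit : Maybe Bool → Bool → Bool
isBit (just false) false = true
isBit (just true)  true  = true
isBit _            _     = false

-- number of senders i from which receiver j received bit v,
-- given the round's received messages  recv sender receiver
count : {n : ℕ} → (Fin n → Fin n → Maybe Bool) → Fin n → Bool → ℕ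
count recv j v = ∣ tabulate (λ i → isBit (recv i j) v) ∣

data Output : Set where
  commit : Bool → Output
  adopt  : Bool → Output

-- Protocol WC (step 1): y_j from round-1 received messages
-- |Q| > 2n/3  is written  2n < 3|Q|
wcValue : (n : ℕ) → (Fin n → Fin n → Maybe Bool) → Fin n → Maybe Bool
wcValue n recv₁ j =
  if (2 * n) <ᵇ (3 * count recv₁ j false) then just false
  else if (2 * n) <ᵇ (3 * count recv₁ j true) then just true
  else nothing

gcBit : {n : ℕ} → (Fin n → Fin n → Maybe Bool) → Fin n → Bool
gcBit recv₂ j =
  if count recv₂ j true ≤ᵇ count recv₂ j false then false else true

gcOutput : (n : ℕ) → (Fin n → Fin n → Maybe Bool) → Fin n → Output
gcOutput n recv₂ j =
  if (2 * n) <ᵇ (3 * count recv₂ j (gcBit recv₂ j))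
  then commit (gcBit recv₂ j)
  else adopt (gcBit recv₂ j)

-- In round r the adversary corrupts a set
-- Cᵣ of at most t processors; messages sent by non-corrupted senders are
-- delivered unchanged, messages of corrupted senders are arbitrary
-- (possibly deleted).  recvᵣ i j = message j receives from i in round r.
record Execution (n t : ℕ) (x : Fin n → Bool) : Set where
  field
    C₁ C₂   : Subset n
    C₁-size : ∣ C₁ ∣ ≤ t
    C₂-size : ∣ C₂ ∣ ≤ t
    recv₁   : Fin n → Fin n → Maybe Bool
    recv₂   : Fin n → Fin n → Maybe Bool
    honest₁ : ∀ i j → i ∉ C₁ → recv₁ i j ≡ just (x i)
    honest₂ : ∀ i j → i ∉ C₂ → recv₂ i j ≡ wcValue n recv₁ i

  output : Fin n → Output
  output = gcOutput n recv₂

SolvesCommitAdopt : {n : ℕ} → (Fin n → Bool) → (Fin n → Output) → Set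
SolvesCommitAdopt {n} x out =
  (∀ (v : Bool) → (∀ i → x i ≡ v) → ∀ j → out j ≡ commit v)
  × (∀ (v : Bool) (j : Fin n) → out j ≡ commit v →
       ∀ k → (out k ≡ commit v) ⊎ (out k ≡ adopt v))

-- In every round at most t senders misbehave, so two receivers' counts of a bit
-- differ by at most t, and a count above t is witnessed by an uncorrupted sender
-- that really sent that bit.  Consequently WC never yields y_i = v and y_k = ¬v:
-- both would need more than 2n/3 receptions, which overlap in more than t
-- senders.  If p_j commits v, it saw more than 2n/3 copies of v, so some y_i = v
-- and no y_k = ¬v; every p_k then receives ¬v at most t times and v more than
-- 2n/3 − t > t times, so b_k = v.  If all inputs are v, every y_i = v and each
-- p_j sees at least n − t > 2n/3 copies of v and at most t of ¬v, so it commits v.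
module Submission where

open import Defs
open import Data.Bool using (Bool; true; false; not)
open import Data.Empty using (⊥-elim)
open import Data.Fin using (Fin)
open import Data.Fin.Properties using (any?)
open import Data.Fin.Subset
  using (Subset; inside; outside; _∈_; _∉_; _⊆_; _∪_; _∩_; ∣_∣; ⊤; ⊥)
open import Data.Fin.Subset.Properties
  using ( _∈?_; ∣p∣≤n; p⊆q⇒∣p∣≤∣q∣; ∣⊤∣≡n; ∣⊥∣≡0
        ; x∈p∪q⁺; x∈p∩q⁻)
open import Data.Maybe using (Maybe; just; nothing)
open import Data.Nat
open import Data.Nat.Properties
open import Data.Nat.Tactic.RingSolver using (solve-∀)
open import Data.Product using (∃; _×_; _,_; proj₂)
open import Data.Sum using (_⊎_; inj₁; inj₂)
open import Data.Vec using (tabulate; _∷_; [])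
open import Data.Vec.Properties using (lookup∘tabulate; []=⇒lookup; lookup⇒[]=)
open import Relation.Binary.PropositionalEquality
open import Function using (_∘_)
open import Relation.Nullary using (¬_; yes; no; ofʸ)
open import Relation.Nullary.Decidable
  using (dec-true; dec-false; decidable-stable; ¬?; _×-dec_)

private
  variable
    n : ℕ

∣p∪q∣+∣p∩q∣≡∣p∣+∣q∣ : (p q : Subset n) → ∣ p ∪ q ∣ + ∣ p ∩ q ∣ ≡ ∣ p ∣ + ∣ q ∣
∣p∪q∣+∣p∩q∣≡∣p∣+∣q∣ []              []              = refl
∣p∪q∣+∣p∩q∣≡∣p∣+∣q∣ (inside  ∷ p) (inside  ∷ q) =
  cong suc (trans (+-suc _ _) (trans (cong suc (∣p∪q∣+∣p∩q∣≡∣p∣+∣q∣ p q)) (sym (+-suc _ _))))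
∣p∪q∣+∣p∩q∣≡∣p∣+∣q∣ (inside  ∷ p) (outside ∷ q) = cong suc (∣p∪q∣+∣p∩q∣≡∣p∣+∣q∣ p q)
∣p∪q∣+∣p∩q∣≡∣p∣+∣q∣ (outside ∷ p) (inside  ∷ q) =
  trans (cong suc (∣p∪q∣+∣p∩q∣≡∣p∣+∣q∣ p q)) (sym (+-suc _ _))
∣p∪q∣+∣p∩q∣≡∣p∣+∣q∣ (outside ∷ p) (outside ∷ q) = ∣p∪q∣+∣p∩q∣≡∣p∣+∣q∣ p q

p⊆q∪r⇒∣p∣≤∣q∣+∣r∣ : {p q r : Subset n} → p ⊆ q ∪ r → ∣ p ∣ ≤ ∣ q ∣ + ∣ r ∣
p⊆q∪r⇒∣p∣≤∣q∣+∣r∣ {p = p} {q} {r} p⊆q∪r = begin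
  ∣ p ∣                    ≤⟨ p⊆q⇒∣p∣≤∣q∣ p⊆q∪r ⟩
  ∣ q ∪ r ∣                ≤⟨ m≤m+n _ _ ⟩
  ∣ q ∪ r ∣ + ∣ q ∩ r ∣    ≡⟨ ∣p∪q∣+∣p∩q∣≡∣p∣+∣q∣ q r ⟩
  ∣ q ∣ + ∣ r ∣            ∎
  where open ≤-Reasoning

p∩q⊆r⇒∣p∣+∣q∣≤n+∣r∣ : {p q r : Subset n} → p ∩ q ⊆ r → ∣ p ∣ + ∣ q ∣ ≤ n + ∣ r ∣
p∩q⊆r⇒∣p∣+∣q∣≤n+∣r∣ {n} {p} {q} {r} p∩q⊆r = begin
  ∣ p ∣ + ∣ q ∣            ≡⟨ ∣p∪q∣+∣p∩q∣≡∣p∣+∣q∣ p q ⟨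
  ∣ p ∪ q ∣ + ∣ p ∩ q ∣    ≤⟨ +-mono-≤ (∣p∣≤n (p ∪ q)) (p⊆q⇒∣p∣≤∣q∣ p∩q⊆r) ⟩
  n + ∣ r ∣                ∎
  where open ≤-Reasoning

∣q∣<∣p∣⇒∃∈p∉q : {p q : Subset n} → ∣ q ∣ < ∣ p ∣ → ∃ λ x → x ∈ p × x ∉ q
∣q∣<∣p∣⇒∃∈p∉q {p = p} {q} ∣q∣<∣p∣ =
  decidable-stable (any? λ x → x ∈? p ×-dec ¬? (x ∈? q)) λ ∄ →
    <⇒≱ ∣q∣<∣p∣ (p⊆q⇒∣p∣≤∣q∣ λ {x} x∈p →
      decidable-stable (x ∈? q) λ x∉q → ∄ (x , x∈p , x∉q))

outside-⊆⇒⊆∪ : {p q r : Subset n} → (∀ {x} → x ∉ r → x ∈ p → x ∈ q) → p ⊆ q ∪ r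
outside-⊆⇒⊆∪ {r = r} h {x} x∈p with x ∈? r
... | yes x∈r = x∈p∪q⁺ (inj₂ x∈r)
... | no  x∉r = x∈p∪q⁺ (inj₁ (h x∉r x∈p))

∈-tabulate⁺ : {f : Fin n → Bool} {x : Fin n} → f x ≡ true → x ∈ tabulate f
∈-tabulate⁺ {f = f} {x} fx = lookup⇒[]= x (tabulate f) (trans (lookup∘tabulate f x) fx)

∈-tabulate⁻ : {f : Fin n → Bool} {x : Fin n} → x ∈ tabulate f → f x ≡ true
∈-tabulate⁻ {f = f} {x} x∈ = trans (sym (lookup∘tabulate f x)) ([]=⇒lookup x∈)

isBit≡true⇒≡just : ∀ msg v → isBit msg v ≡ true → msg ≡ just v
isBit≡true⇒≡just (just false) false _ = refl
isBit≡true⇒≡just (just true)  true  _ = refl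
isBit≡true⇒≡just (just false) true  ()
isBit≡true⇒≡just (just true)  false ()
isBit≡true⇒≡just nothing      _     ()

isBit-just : ∀ v → isBit (just v) v ≡ true
isBit-just false = refl
isBit-just true  = refl

just≢just-not : ∀ v → just v ≢ just (not v)
just≢just-not false ()
just≢just-not true  ()

Messages : ℕ → Set
Messages n = Fin n → Fin n → Maybe Bool

module Round {n t : ℕ}
  (recv : Messages n) (C : Subset n) (∣C∣≤t : ∣ C ∣ ≤ t)
  (sent : Fin n → Maybe Bool) (honest : ∀ i j → i ∉ C → recv i j ≡ sent i)
  where

  -- count recv j v is definitionally ∣ received j v ∣.
  received : Fin n → Bool → Subset n
  received j v = tabulate λ i → isBit (recv i j) v

  ∈received⇒sent : ∀ {i j v} → i ∉ C → i ∈ received j v → sent i ≡ just v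
  ∈received⇒sent {i} {j} {v} i∉C i∈ =
    trans (sym (honest i j i∉C)) (isBit≡true⇒≡just _ v (∈-tabulate⁻ i∈))

  sent⇒∈received : ∀ {i j v} → i ∉ C → sent i ≡ just v → i ∈ received j v
  sent⇒∈received {i} {j} {v} i∉C sent≡v =
    ∈-tabulate⁺ (subst (λ msg → isBit msg v ≡ true)
                       (sym (trans (honest i j i∉C) sent≡v)) (isBit-just v))

  ⊆∪C⇒≤+t : ∀ p q → p ⊆ q ∪ C → ∣ p ∣ ≤ ∣ q ∣ + t
  ⊆∪C⇒≤+t _ _ p⊆q∪C = ≤-trans (p⊆q∪r⇒∣p∣≤∣q∣+∣r∣ p⊆q∪C) (+-monoʳ-≤ _ ∣C∣≤t)

  count≤count+t : ∀ j k v → count recv j v ≤ count recv k v + t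
  count≤count+t j k v =
    ⊆∪C⇒≤+t (received j v) (received k v)
      (outside-⊆⇒⊆∪ λ i∉C i∈ → sent⇒∈received i∉C (∈received⇒sent i∉C i∈))

  unanimous⇒n≤count+t : ∀ j v → (∀ i → sent i ≡ just v) → n ≤ count recv j v + t
  unanimous⇒n≤count+t j v unanimous = begin
    n                   ≡⟨ ∣⊤∣≡n n ⟨
    ∣ ⊤ {n} ∣           ≤⟨ ⊆∪C⇒≤+t ⊤ (received j v) ⊤⊆received∪C ⟩
    count recv j v + t  ∎
    where
    open ≤-Reasoning
    ⊤⊆received∪C : ⊤ ⊆ received j v ∪ C
    ⊤⊆received∪C = outside-⊆⇒⊆∪ λ i∉C _ → sent⇒∈received i∉C (unanimous _)

  unsent⇒count≤t : ∀ j v → (∀ i → sent i ≢ just v) → count recv j v ≤ t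
  unsent⇒count≤t j v unsent = begin
    count recv j v  ≤⟨ ⊆∪C⇒≤+t (received j v) ⊥ received⊆⊥∪C ⟩
    ∣ ⊥ {n} ∣ + t   ≡⟨ cong (_+ t) (∣⊥∣≡0 n) ⟩
    t               ∎
    where
    open ≤-Reasoning
    received⊆⊥∪C : received j v ⊆ ⊥ ∪ C
    received⊆⊥∪C = outside-⊆⇒⊆∪ λ i∉C i∈ → ⊥-elim (unsent _ (∈received⇒sent i∉C i∈))

  unanimous⇒count-not≤t : ∀ j v → (∀ i → sent i ≡ just v) → count recv j (not v) ≤ t
  unanimous⇒count-not≤t j v unanimous =
    unsent⇒count≤t j (not v) λ i → just≢just-not v ∘ trans (sym (unanimous i))

  t<count⇒sent : ∀ j v → t < count recv j v → ∃ λ i → sent i ≡ just v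
  t<count⇒sent j v t<count with ∣q∣<∣p∣⇒∃∈p∉q (≤-<-trans ∣C∣≤t t<count)
  ... | i , i∈ , i∉C = i , ∈received⇒sent i∉C i∈

  count+count-not≤n+t : ∀ j k v → count recv j v + count recv k (not v) ≤ n + t
  count+count-not≤n+t j k v =
    ≤-trans (p∩q⊆r⇒∣p∣+∣q∣≤n+∣r∣ conflicting⊆C) (+-monoʳ-≤ n ∣C∣≤t)
    where
    conflicting⊆C : received j v ∩ received k (not v) ⊆ C
    conflicting⊆C {i} i∈ with x∈p∩q⁻ (received j v) (received k (not v)) i∈
    ... | i∈v , i∈¬v = decidable-stable (i ∈? C) λ i∉C →
      just≢just-not v (trans (sym (∈received⇒sent i∉C i∈v)) (∈received⇒sent i∉C i∈¬v))

<ᵇ≡true : ∀ {a b} → a < b → (a <ᵇ b) ≡ true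
<ᵇ≡true {a} {b} = dec-true (a <? b)

<ᵇ≡false : ∀ {a b} → b ≤ a → (a <ᵇ b) ≡ false
<ᵇ≡false {a} {b} b≤a = dec-false (a <? b) (≤⇒≯ b≤a)

≤ᵇ≡true : ∀ {a b} → a ≤ b → (a ≤ᵇ b) ≡ true
≤ᵇ≡true {a} {b} = dec-true (a ≤? b)

≤ᵇ≡false : ∀ {a b} → b < a → (a ≤ᵇ b) ≡ false
≤ᵇ≡false {a} {b} b<a = dec-false (a ≤? b) (<⇒≱ b<a)

wcValue-just : ∀ n (recv : Messages n) j v →
  2 * n < 3 * count recv j v → 3 * count recv j (not v) ≤ 2 * n → wcValue n recv j ≡ just v
wcValue-just n recv j false >⅔ _ rewrite <ᵇ≡true >⅔ = refl
wcValue-just n recv j true >⅔ ≤⅔ rewrite <ᵇ≡false ≤⅔ | <ᵇ≡true >⅔ = refl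

wcValue≡just⇒>⅔n : ∀ n (recv : Messages n) j v →
  wcValue n recv j ≡ just v → 2 * n < 3 * count recv j v
wcValue≡just⇒>⅔n n recv j v eq
  with 2 * n <ᵇ 3 * count recv j false | <ᵇ-reflects-< (2 * n) (3 * count recv j false)
     | 2 * n <ᵇ 3 * count recv j true  | <ᵇ-reflects-< (2 * n) (3 * count recv j true)
wcValue≡just⇒>⅔n n recv j false refl | true  | ofʸ >⅔ | _     | _      = >⅔
wcValue≡just⇒>⅔n n recv j true  ()   | true  | _      | _     | _
wcValue≡just⇒>⅔n n recv j true  refl | false | _      | true  | ofʸ >⅔ = >⅔
wcValue≡just⇒>⅔n n recv j false ()   | false | _      | true  | _
wcValue≡just⇒>⅔n n recv j _     ()   | false | _      | false | _

gcBit-majority : ∀ {n} (recv : Messages n) k v →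
  count recv k (not v) < count recv k v → gcBit recv k ≡ v
gcBit-majority recv k false majority rewrite ≤ᵇ≡true (<⇒≤ majority) = refl
gcBit-majority recv k true  majority rewrite ≤ᵇ≡false majority = refl

gcOutput-commit : ∀ n (recv : Messages n) k {v} →
  gcBit recv k ≡ v → 2 * n < 3 * count recv k v → gcOutput n recv k ≡ commit v
gcOutput-commit n recv k refl >⅔ rewrite <ᵇ≡true >⅔ = refl

gcOutput≡commit⇒ : ∀ n (recv : Messages n) k v →
  gcOutput n recv k ≡ commit v → gcBit recv k ≡ v × 2 * n < 3 * count recv k v
gcOutput≡commit⇒ n recv k v eq
  with 2 * n <ᵇ 3 * count recv k (gcBit recv k)
     | <ᵇ-reflects-< (2 * n) (3 * count recv k (gcBit recv k))
gcOutput≡commit⇒ n recv k _ refl | true  | ofʸ >⅔ = refl , >⅔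
gcOutput≡commit⇒ n recv k _ ()   | false | _

gcOutput-commit-or-adopt : ∀ n (recv : Messages n) k →
  gcOutput n recv k ≡ commit (gcBit recv k) ⊎ gcOutput n recv k ≡ adopt (gcBit recv k)
gcOutput-commit-or-adopt n recv k with 2 * n <ᵇ 3 * count recv k (gcBit recv k)
... | true  = inj₁ refl
... | false = inj₂ refl

module Resilience {n t : ℕ} (3t<n : 3 * t < n) where

  n∸t>⅔n : ∀ {q} → n ≤ q + t → 2 * n < 3 * q
  n∸t>⅔n {q} n≤q+t = +-cancelʳ-< n (2 * n) (3 * q) (begin-strict
    2 * n + n      ≡⟨ +-comm (2 * n) n ⟩
    3 * n          ≤⟨ *-monoʳ-≤ 3 n≤q+t ⟩
    3 * (q + t)    ≡⟨ *-distribˡ-+ 3 q t ⟩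
    3 * q + 3 * t  <⟨ +-monoʳ-< (3 * q) 3t<n ⟩
    3 * q + n      ∎)
    where open ≤-Reasoning

  ≤t⇒≤⅔n : ∀ {q} → q ≤ t → 3 * q ≤ 2 * n
  ≤t⇒≤⅔n q≤t = ≤-trans (*-monoʳ-≤ 3 q≤t) (≤-trans (<⇒≤ 3t<n) (m≤m+n n _))

  >⅔n⇒∸t>t : ∀ {a b} → 2 * n < 3 * a → a ≤ b + t → t < b
  >⅔n⇒∸t>t {a} {b} >⅔ a≤b+t = ≰⇒> λ b≤t → <-asym >⅔ (begin-strict
    3 * a          ≤⟨ *-monoʳ-≤ 3 (≤-trans a≤b+t (+-monoˡ-≤ t b≤t)) ⟩
    3 * (t + t)    ≡⟨ 3[t+t]≡2[3t] t ⟩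
    2 * (3 * t)    <⟨ *-monoʳ-< 2 3t<n ⟩
    2 * n          ∎)
    where
    open ≤-Reasoning
    3[t+t]≡2[3t] : ∀ t → 3 * (t + t) ≡ 2 * (3 * t)
    3[t+t]≡2[3t] = solve-∀

  >⅔n⇒>t : ∀ {a} → 2 * n < 3 * a → t < a
  >⅔n⇒>t {a} >⅔ = >⅔n⇒∸t>t >⅔ (m≤m+n a t)

  >⅔n+>⅔n≰n+t : ∀ {a b} → 2 * n < 3 * a → 2 * n < 3 * b → ¬ (a + b ≤ n + t)
  >⅔n+>⅔n≰n+t {a} {b} >⅔a >⅔b a+b≤n+t = <-irrefl refl (begin-strict
    2 * n + 2 * n  <⟨ +-mono-< >⅔a >⅔b ⟩
    3 * a + 3 * b  ≡⟨ *-distribˡ-+ 3 a b ⟨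
    3 * (a + b)    ≤⟨ *-monoʳ-≤ 3 a+b≤n+t ⟩
    3 * (n + t)    ≡⟨ *-distribˡ-+ 3 n t ⟩
    3 * n + 3 * t  <⟨ +-monoʳ-< (3 * n) 3t<n ⟩
    3 * n + n      ≡⟨ 3n+n≡2n+2n n ⟩
    2 * n + 2 * n  ∎)
    where
    open ≤-Reasoning
    3n+n≡2n+2n : ∀ n → 3 * n + n ≡ 2 * n + 2 * n
    3n+n≡2n+2n = solve-∀

  wcValue-unanimous : ∀ (recv : Messages n) j v →
    n ≤ count recv j v + t → count recv j (not v) ≤ t → wcValue n recv j ≡ just v
  wcValue-unanimous recv j v n≤count+t count-not≤t =
    wcValue-just n recv j v (n∸t>⅔n n≤count+t) (≤t⇒≤⅔n count-not≤t)

  gcOutput-unanimous : ∀ (recv : Messages n) j v →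
    n ≤ count recv j v + t → count recv j (not v) ≤ t → gcOutput n recv j ≡ commit v
  gcOutput-unanimous recv j v n≤count+t count-not≤t =
    gcOutput-commit n recv j (gcBit-majority recv j v (≤-<-trans count-not≤t (>⅔n⇒>t >⅔))) >⅔
    where
    >⅔ : 2 * n < 3 * count recv j v
    >⅔ = n∸t>⅔n n≤count+t

module GC {n t : ℕ} (3t<n : 3 * t < n) {x : Fin n → Bool} (e : Execution n t x) where
  open Execution e
  open Resilience {n} {t} 3t<n
  module R₁ = Round recv₁ C₁ C₁-size (just ∘ x) honest₁
  module R₂ = Round recv₂ C₂ C₂-size (wcValue n recv₁) honest₂

  wc-unanimous : ∀ v → (∀ i → x i ≡ v) → ∀ i → wcValue n recv₁ i ≡ just v
  wc-unanimous v x≡v i = wcValue-unanimous recv₁ i v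
    (R₁.unanimous⇒n≤count+t i v (cong just ∘ x≡v)) (R₁.unanimous⇒count-not≤t i v (cong just ∘ x≡v))

  wc-agreement : ∀ {i k v} → wcValue n recv₁ i ≡ just v → wcValue n recv₁ k ≢ just (not v)
  wc-agreement {i} {k} {v} yᵢ≡v yₖ≡¬v = >⅔n+>⅔n≰n+t {count recv₁ i v} {count recv₁ k (not v)}
    (wcValue≡just⇒>⅔n n recv₁ i v yᵢ≡v) (wcValue≡just⇒>⅔n n recv₁ k (not v) yₖ≡¬v)
    (R₁.count+count-not≤n+t i k v)

  validity : ∀ v → (∀ i → x i ≡ v) → ∀ j → output j ≡ commit v
  validity v x≡v j = gcOutput-unanimous recv₂ j v
    (R₂.unanimous⇒n≤count+t j v y≡v) (R₂.unanimous⇒count-not≤t j v y≡v)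
    where
    y≡v : ∀ i → wcValue n recv₁ i ≡ just v
    y≡v = wc-unanimous v x≡v

  agreement : ∀ v j → output j ≡ commit v → ∀ k → output k ≡ commit v ⊎ output k ≡ adopt v
  agreement v j commits k =
    subst (λ b → output k ≡ commit b ⊎ output k ≡ adopt b) bₖ≡v (gcOutput-commit-or-adopt n recv₂ k)
    where
    >⅔ : 2 * n < 3 * count recv₂ j v
    >⅔ = proj₂ (gcOutput≡commit⇒ n recv₂ j v commits)
    some-y≡v : ∃ λ i → wcValue n recv₁ i ≡ just v
    some-y≡v = R₂.t<count⇒sent j v (>⅔n⇒>t >⅔)
    count-not≤t : count recv₂ k (not v) ≤ t
    count-not≤t = R₂.unsent⇒count≤t k (not v) λ i → wc-agreement (proj₂ some-y≡v)
    t<count : t < count recv₂ k v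
    t<count = >⅔n⇒∸t>t >⅔ (R₂.count≤count+t j k v)
    bₖ≡v : gcBit recv₂ k ≡ v
    bₖ≡v = gcBit-majority recv₂ k v (≤-<-trans count-not≤t t<count)

theorem5p3 : (n t : ℕ) → 3 * t < n → (x : Fin n → Bool) →
    (e : Execution n t x) → SolvesCommitAdopt x (Execution.output e)
theorem5p3 n t 3t<n x e = GC.validity 3t<n e , GC.agreement 3t<n e
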